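{- Let $N\ge1$, $f:\mathbb{N}^N\to\mathbb{N}$, $k\ge0$ and $\boldsymbol{\ell}\in\mathbb{N}^N$. Then: (a) if $k$ is even and $\boldsymbol{\ell}$ has at least one odd entry, $\binom{k}{\boldsymbol{\ell}}_f\equiv0\pmod 2$; (b) if $k$ is even and all entries of $\boldsymbol{\ell}$ are even, $\binom{k}{\boldsymbol{\ell}}_f\equiv\binom{k/2}{\boldsymbol{\ell}/2}_f\pmod 2$; (c) if $k$ is odd, $\displaystyle\binom{k}{\boldsymbol{\ell}}_f\equiv\sum_{\mathbf{s}}f(\mathbf{s})\binom{\lfloor k/2\rfloor}{(\boldsymbol{\ell}-\mathbf{s})/2}_f\pmod 2$, the sum over all $\mathbf{s}\in\mathbb{N}^N$ such that $\boldsymbol{\ell}-\mathbf{s}\in\mathbb{N}^N$ has only even entries.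
   Context: $\mathbb{N}=\{0,1,2,\dots\}$. For $k\ge0$ and $\boldsymbol{\ell}\in\mathbb{N}^N$, $\binom{k}{\boldsymbol{\ell}}_f=\sum f(\mathbf{m}_1)\cdots f(\mathbf{m}_k)$ over all ordered $k$-tuples of vectors $\mathbf{m}_j\in\mathbb{N}^N$ with $\mathbf{m}_1+\cdots+\mathbf{m}_k=\boldsymbol{\ell}$ (for $k=0$: $1$ if $\boldsymbol{\ell}=\mathbf{0}$, else $0$); the number of $f$-weighted vector compositions of $\boldsymbol{\ell}$ with $k$ parts. -}

module Defs where

open import Data.Nat using (ℕ; zero; suc; _+_; _*_; _∸_; _≟_; _≤?_)
open import Data.Nat.Base using (_/_; _%_)
open import Data.Vec using (Vec; []; _∷_; zipWith; replicate; map; allFin; lookup)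
open import Data.List as L using (List; []; _∷_; concatMap; upTo; filter)
open import Data.Nat.ListAction using (sum)
open import Data.Product using (_×_; _,_)
open import Data.Bool using (Bool; true; false; _∧_; if_then_else_)
open import Relation.Nullary.Decidable using (⌊_⌋)
open import Data.Fin using (Fin)

_⊕_ : ∀ {N} → Vec ℕ N → Vec ℕ N → Vec ℕ N
_⊕_ = zipWith _+_

𝟎 : ∀ {N} → Vec ℕ N
𝟎 = replicate _ 0

box : ∀ {N} → Vec ℕ N → List (Vec ℕ N)
box [] = [] ∷ []
box (l ∷ ls) = concatMap (λ a → L.map (a ∷_) (box ls)) (upTo (suc l))

tuples : ∀ {A : Set} → ℕ → List A → List (List A)
tuples zero xs = [] ∷ []
tuples (suc k) xs = concatMap (λ x → L.map (x ∷_) (tuples k xs)) xs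

vsum : ∀ {N} → List (Vec ℕ N) → Vec ℕ N
vsum = L.foldr _⊕_ 𝟎

prodf : ∀ {N} → (Vec ℕ N → ℕ) → List (Vec ℕ N) → ℕ
prodf f = L.foldr (λ m r → f m * r) 1

-- Any such part satisfies mⱼ ≤ ℓ componentwise,
--   so the sum ranges over k-tuples drawn from box ℓ (this is the full,
--   finite index set).  For k = 0 the only tuple is the empty one, with
--   sum 𝟎 and empty product 1, giving [ℓ = 𝟎].
binom : ∀ {N} → (Vec ℕ N → ℕ) → ℕ → Vec ℕ N → ℕ
binom f k ℓ = sum (L.map (prodf f) (filter (λ ms → vsum ms ≟v ℓ) (tuples k (box ℓ))))
  where
    open import Relation.Nullary using (Dec; yes; no)
    open import Data.Vec.Properties using (≡-dec)
    open import Relation.Binary.PropositionalEquality using (_≡_)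
    _≟v_ : ∀ {N} → (u v : Vec ℕ N) → Dec (u ≡ v)
    _≟v_ = ≡-dec _≟_

half : ∀ {N} → Vec ℕ N → Vec ℕ N
half = map (_/ 2)

_⊖_ : ∀ {N} → Vec ℕ N → Vec ℕ N → Vec ℕ N
_⊖_ = zipWith _∸_

allEven? : ∀ {N} → Vec ℕ N → Bool
allEven? [] = true
allEven? (x ∷ xs) = ⌊ x % 2 ≟ 0 ⌋ ∧ allEven? xs

-- Right-hand side of (c): Σ f(s) · binom f ⌊k/2⌋ ((ℓ-s)/2) over all s ∈ ℕ^N
-- with ℓ - s ∈ ℕ^N (i.e. s ≤ ℓ componentwise, i.e. s ∈ box ℓ) having only even entries.
sumC : ∀ {N} → (Vec ℕ N → ℕ) → ℕ → Vec ℕ N → ℕ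
sumC f k ℓ = sum (L.map (λ s → f s * binom f (k / 2) (half (ℓ ⊖ s)))
                        (filter (λ s → T? (allEven? (ℓ ⊖ s))) (box ℓ)))
  where open import Data.Bool using (T?)

module Submission where

-- The compositions of ℓ into k parts index the terms of the k-th convolution power f^{*k}, so
-- binom f k = f^{*k}.  Modulo 2 convolution squares like the Frobenius map: in g * g the terms
-- at m and ℓ − m coincide and cancel in pairs, leaving only the middle term g(ℓ/2)² ≡ g(ℓ/2),
-- present exactly when ℓ is even.  Hence f^{*2h} ≡ f^{*h} dilated by 2, and
-- f^{*(2h+1)} = f * f^{*2h}; these are (a), (b) and (c).

open import Defs
open import Data.Bool using (true; false; if_then_else_; T; T?)
open import Data.Bool.Properties using (∧-zeroʳ)
open import Data.Empty using (⊥-elim)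
open import Data.Fin using (Fin; zero; suc)
open import Data.List as L using (List; []; _∷_)
open import Data.List.Properties using (map-cong; map-∘; map-++)
open import Data.Nat using (ℕ; zero; suc; _+_; _*_; _∸_; _≤_; _≥_; z≤n; s≤s; _≤?_; _≟_; _%_; _/_; parity)
open import Data.Nat.DivMod using (m≡m%n+[m/n]*n; m/n≡1+[m∸n]/n; m/n≤m)
open import Data.Nat.ListAction using (sum)
open import Data.Nat.ListAction.Properties using (sum-++)
open import Data.Nat.Properties
open import Algebra.Properties.CommutativeSemigroup +-commutativeSemigroup using (interchange; x∙yz≈y∙xz)
open import Data.Parity.Base as ℙ using (0ℙ)
open import Data.Parity.Properties as ℙₚ using (+-homo-+; *-homo-*; p+p≡0ℙ; *-idem)
open import Data.Product using (_×_; _,_; ∃)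
open import Data.Unit using (tt)
open import Data.Vec using (Vec; []; _∷_; lookup; map)
open import Data.Vec.Relation.Unary.All using (All; []; _∷_)
open import Data.Vec.Relation.Binary.Pointwise.Inductive as Pointwise using (Pointwise; []; _∷_)
open import Relation.Nullary using (Dec; yes; no; does; ¬_)
open import Relation.Nullary.Decidable using (dec-true; ⌊_⌋)
open import Relation.Unary using (Decidable)
open import Relation.Binary.PropositionalEquality
open ≡-Reasoning

private
  variable
    N : ℕ

-- suc (suc m) % 2 reduces to m % 2 definitionally.
parity⇒%2≡ : ∀ m n → parity m ≡ parity n → m % 2 ≡ n % 2
parity⇒%2≡ (suc (suc m)) n       p = parity⇒%2≡ m n p
parity⇒%2≡ m       (suc (suc n)) p = parity⇒%2≡ m n p
parity⇒%2≡ 0 0 p = refl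
parity⇒%2≡ 1 1 p = refl

parity-cong-+ : ∀ {a b c d} → parity a ≡ parity b → parity c ≡ parity d →
                parity (a + c) ≡ parity (b + d)
parity-cong-+ {a} {b} {c} {d} p q = begin
  parity (a + c)        ≡⟨ +-homo-+ a c ⟩
  parity a ℙ.+ parity c ≡⟨ cong₂ ℙ._+_ p q ⟩
  parity b ℙ.+ parity d ≡⟨ +-homo-+ b d ⟨
  parity (b + d)        ∎

parity-cong-* : ∀ {a b c d} → parity a ≡ parity b → parity c ≡ parity d →
                parity (a * c) ≡ parity (b * d)
parity-cong-* {a} {b} {c} {d} p q = begin
  parity (a * c)        ≡⟨ *-homo-* a c ⟩
  parity a ℙ.* parity c ≡⟨ cong₂ ℙ._*_ p q ⟩
  parity b ℙ.* parity d ≡⟨ *-homo-* b d ⟨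
  parity (b * d)        ∎

parity[m+m]≡0ℙ : ∀ m → parity (m + m) ≡ 0ℙ
parity[m+m]≡0ℙ m = trans (+-homo-+ m m) (p+p≡0ℙ (parity m))

parity[m+[n+m]]≡parity[n] : ∀ m n → parity (m + (n + m)) ≡ parity n
parity[m+[n+m]]≡parity[n] m n = begin
  parity (m + (n + m))        ≡⟨ cong parity (x∙yz≈y∙xz m n m) ⟩
  parity (n + (m + m))        ≡⟨ +-homo-+ n (m + m) ⟩
  parity n ℙ.+ parity (m + m) ≡⟨ cong (parity n ℙ.+_) (parity[m+m]≡0ℙ m) ⟩
  parity n ℙ.+ 0ℙ             ≡⟨ ℙₚ.+-identityʳ (parity n) ⟩
  parity n                    ∎

parity[m*m]≡parity[m] : ∀ m → parity (m * m) ≡ parity m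
parity[m*m]≡parity[m] m = trans (*-homo-* m m) (*-idem (parity m))

n≡n%2+[n/2+n/2] : ∀ n → n ≡ n % 2 + (n / 2 + n / 2)
n≡n%2+[n/2+n/2] n = begin
  n                             ≡⟨ m≡m%n+[m/n]*n n 2 ⟩
  n % 2 + n / 2 * 2             ≡⟨ cong (n % 2 +_) (*-comm (n / 2) 2) ⟩
  n % 2 + (n / 2 + (n / 2 + 0)) ≡⟨ cong (λ z → n % 2 + (n / 2 + z)) (+-identityʳ (n / 2)) ⟩
  n % 2 + (n / 2 + n / 2)       ∎

even⇒≡half+half : ∀ n → n % 2 ≡ 0 → n ≡ n / 2 + n / 2
even⇒≡half+half n n-even = trans (n≡n%2+[n/2+n/2] n) (cong (_+ (n / 2 + n / 2)) n-even)

odd⇒≡suc[half+half] : ∀ n → n % 2 ≡ 1 → n ≡ suc (n / 2 + n / 2)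
odd⇒≡suc[half+half] n n-odd = trans (n≡n%2+[n/2+n/2] n) (cong (_+ (n / 2 + n / 2)) n-odd)

[2+n]/2≡1+n/2 : ∀ n → suc (suc n) / 2 ≡ suc (n / 2)
[2+n]/2≡1+n/2 n = m/n≡1+[m∸n]/n {suc (suc n)} {2} (s≤s (s≤s z≤n))

n∸n/2≡n/2 : ∀ n → n % 2 ≡ 0 → n ∸ n / 2 ≡ n / 2
n∸n/2≡n/2 n n-even =
  trans (cong (_∸ n / 2) (even⇒≡half+half n n-even)) (m+n∸m≡n (n / 2) (n / 2))

infix 4 _≼_ _≼?_

_≼_ : Vec ℕ N → Vec ℕ N → Set
_≼_ = Pointwise _≤_

_≼?_ : (u v : Vec ℕ N) → Dec (u ≼ v)
_≼?_ = Pointwise.decidable _≤?_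

v⊖u≼v : (v u : Vec ℕ N) → v ⊖ u ≼ v
v⊖u≼v []      []      = []
v⊖u≼v (x ∷ v) (y ∷ u) = m∸n≤m x y ∷ v⊖u≼v v u

u≼u⊕v : (u v : Vec ℕ N) → u ≼ u ⊕ v
u≼u⊕v []      []      = []
u≼u⊕v (x ∷ u) (y ∷ v) = m≤m+n x y ∷ u≼u⊕v u v

u⊕[v⊖u]≡v : {u v : Vec ℕ N} → u ≼ v → u ⊕ (v ⊖ u) ≡ v
u⊕[v⊖u]≡v []         = refl
u⊕[v⊖u]≡v (x≤y ∷ u≼v) = cong₂ _∷_ (m+[n∸m]≡n x≤y) (u⊕[v⊖u]≡v u≼v)

[u⊕v]⊖u≡v : (u v : Vec ℕ N) → (u ⊕ v) ⊖ u ≡ v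
[u⊕v]⊖u≡v []      []      = refl
[u⊕v]⊖u≡v (x ∷ u) (y ∷ v) = cong₂ _∷_ (m+n∸m≡n x y) ([u⊕v]⊖u≡v u v)

v⊖𝟎≡v : (v : Vec ℕ N) → v ⊖ 𝟎 ≡ v
v⊖𝟎≡v []      = refl
v⊖𝟎≡v (x ∷ v) = cong (x ∷_) (v⊖𝟎≡v v)

v⊖[v⊖u]≡u : {u v : Vec ℕ N} → u ≼ v → v ⊖ (v ⊖ u) ≡ u
v⊖[v⊖u]≡u []          = refl
v⊖[v⊖u]≡u (x≤y ∷ u≼v) = cong₂ _∷_ (m∸[m∸n]≡n x≤y) (v⊖[v⊖u]≡u u≼v)

[w⊖u]⊖[v⊖u]≡w⊖v : {u v w : Vec ℕ N} → u ≼ v → v ≼ w → (w ⊖ u) ⊖ (v ⊖ u) ≡ w ⊖ v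
[w⊖u]⊖[v⊖u]≡w⊖v [] [] = refl
[w⊖u]⊖[v⊖u]≡w⊖v {u = x ∷ _} {y ∷ _} {z ∷ _} (x≤y ∷ u≼v) (_ ∷ v≼w) =
  cong₂ _∷_ (trans (∸-+-assoc z x (y ∸ x)) (cong (z ∸_) (m+[n∸m]≡n x≤y)))
            ([w⊖u]⊖[v⊖u]≡w⊖v u≼v v≼w)

v⊖half[v]≡half[v] : (v : Vec ℕ N) → allEven? v ≡ true → v ⊖ half v ≡ half v
v⊖half[v]≡half[v] []      _ = refl
v⊖half[v]≡half[v] (x ∷ v) e with x % 2 ≟ 0
... | yes x-even = cong₂ _∷_ (n∸n/2≡n/2 x x-even) (v⊖half[v]≡half[v] v e)
v⊖half[v]≡half[v] (x ∷ v) () | no _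

allEven?≡false : (v : Vec ℕ N) → ∃ (λ i → lookup v i % 2 ≡ 1) → allEven? v ≡ false
allEven?≡false (x ∷ v) (zero  , x-odd) rewrite x-odd = refl
allEven?≡false (x ∷ v) (suc i , odd)   rewrite allEven?≡false v (i , odd) = ∧-zeroʳ _

allEven?≡true : (v : Vec ℕ N) → All (λ x → x % 2 ≡ 0) v → allEven? v ≡ true
allEven?≡true []      []               = refl
allEven?≡true (x ∷ v) (x-even ∷ evens) rewrite x-even = allEven?≡true v evens

sumTo : ℕ → (ℕ → ℕ) → ℕ
sumTo zero    H = H 0
sumTo (suc l) H = H 0 + sumTo l (λ a → H (suc a))

syntax sumTo l (λ a → e) = Σ[ a ≤ l ] e

sumTo-cong : ∀ l {H K : ℕ → ℕ} → (∀ a → a ≤ l → H a ≡ K a) → sumTo l H ≡ sumTo l K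
sumTo-cong zero    H≡K = H≡K 0 z≤n
sumTo-cong (suc l) H≡K = cong₂ _+_ (H≡K 0 z≤n) (sumTo-cong l (λ a a≤l → H≡K (suc a) (s≤s a≤l)))

sumTo-cong-parity : ∀ l {H K : ℕ → ℕ} → (∀ a → a ≤ l → parity (H a) ≡ parity (K a)) →
                    parity (sumTo l H) ≡ parity (sumTo l K)
sumTo-cong-parity zero    H≡K = H≡K 0 z≤n
sumTo-cong-parity (suc l) {H} {K} H≡K =
  parity-cong-+ {H 0} {K 0} {sumTo l (λ a → H (suc a))} {sumTo l (λ a → K (suc a))}
                (H≡K 0 z≤n) (sumTo-cong-parity l (λ a a≤l → H≡K (suc a) (s≤s a≤l)))

sumTo-+ : ∀ l (H K : ℕ → ℕ) → Σ[ a ≤ l ] (H a + K a) ≡ sumTo l H + sumTo l K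
sumTo-+ zero    H K = refl
sumTo-+ (suc l) H K = begin
  H 0 + K 0 + Σ[ a ≤ l ] (H (suc a) + K (suc a))
    ≡⟨ cong (H 0 + K 0 +_) (sumTo-+ l (λ a → H (suc a)) (λ a → K (suc a))) ⟩
  H 0 + K 0 + (Σ[ a ≤ l ] H (suc a) + Σ[ a ≤ l ] K (suc a))
    ≡⟨ interchange (H 0) (K 0) _ _ ⟩
  H 0 + Σ[ a ≤ l ] H (suc a) + (K 0 + Σ[ a ≤ l ] K (suc a)) ∎

sumTo-*ˡ : ∀ l c (H : ℕ → ℕ) → Σ[ a ≤ l ] (c * H a) ≡ c * sumTo l H
sumTo-*ˡ zero    c H = refl
sumTo-*ˡ (suc l) c H =
  trans (cong (c * H 0 +_) (sumTo-*ˡ l c (λ a → H (suc a)))) (sym (*-distribˡ-+ c (H 0) _))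

sumTo-snoc : ∀ l (H : ℕ → ℕ) → sumTo (suc l) H ≡ sumTo l H + H (suc l)
sumTo-snoc zero    H = refl
sumTo-snoc (suc l) H =
  trans (cong (H 0 +_) (sumTo-snoc l (λ a → H (suc a)))) (sym (+-assoc (H 0) _ _))

sumTo-reverse : ∀ l (H : ℕ → ℕ) → sumTo l H ≡ Σ[ a ≤ l ] H (l ∸ a)
sumTo-reverse zero    H = refl
sumTo-reverse (suc l) H = begin
  H 0 + Σ[ a ≤ l ] H (suc a)
    ≡⟨ cong (H 0 +_) (sumTo-reverse l (λ a → H (suc a))) ⟩
  H 0 + Σ[ a ≤ l ] H (suc (l ∸ a))
    ≡⟨ cong (H 0 +_) (sumTo-cong l (λ a a≤l → cong H (sym (+-∸-assoc 1 a≤l)))) ⟩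
  H 0 + Σ[ a ≤ l ] H (suc l ∸ a)
    ≡⟨ +-comm (H 0) _ ⟩
  Σ[ a ≤ l ] H (suc l ∸ a) + H 0
    ≡⟨ cong (λ z → Σ[ a ≤ l ] H (suc l ∸ a) + H z) (n∸n≡0 l) ⟨
  Σ[ a ≤ l ] H (suc l ∸ a) + H (l ∸ l)
    ≡⟨ sumTo-snoc l (λ a → H (suc l ∸ a)) ⟨
  Σ[ a ≤ suc l ] H (suc l ∸ a) ∎

sumTo-triangle : ∀ l (K : ℕ → ℕ → ℕ) →
                 Σ[ a ≤ l ] Σ[ b ≤ l ∸ a ] K a b ≡ Σ[ c ≤ l ] Σ[ a ≤ c ] K a (c ∸ a)
sumTo-triangle zero    K = refl
sumTo-triangle (suc l) K = begin
  Σ[ b ≤ suc l ] K 0 b + Σ[ a ≤ l ] Σ[ b ≤ l ∸ a ] K (suc a) b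
    ≡⟨ cong (Σ[ b ≤ suc l ] K 0 b +_) (sumTo-triangle l (λ a → K (suc a))) ⟩
  K 0 0 + Σ[ c ≤ l ] K 0 (suc c) + Σ[ c ≤ l ] Σ[ a ≤ c ] K (suc a) (c ∸ a)
    ≡⟨ +-assoc (K 0 0) _ _ ⟩
  K 0 0 + (Σ[ c ≤ l ] K 0 (suc c) + Σ[ c ≤ l ] Σ[ a ≤ c ] K (suc a) (c ∸ a))
    ≡⟨ cong (K 0 0 +_) (sumTo-+ l (λ c → K 0 (suc c)) (λ c → Σ[ a ≤ c ] K (suc a) (c ∸ a))) ⟨
  K 0 0 + Σ[ c ≤ l ] Σ[ a ≤ suc c ] K a (suc c ∸ a) ∎

sumTo-truncate : ∀ {l L} (H : ℕ → ℕ) → l ≤ L →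
                 Σ[ a ≤ L ] (if does (a ≤? l) then H a else 0) ≡ sumTo l H
sumTo-truncate {zero}  {zero}  H _ = refl
sumTo-truncate {zero}  {suc L} H _ = trans (cong (H 0 +_) (sumTo-*ˡ L 0 (λ _ → 0))) (+-identityʳ (H 0))
sumTo-truncate {suc l} {suc L} H (s≤s l≤L) =
  cong (H 0 +_) (trans (sumTo-cong L shift) (sumTo-truncate (λ a → H (suc a)) l≤L))
  where
  shift : ∀ a → a ≤ L → (if does (suc a ≤? suc l) then H (suc a) else 0)
                      ≡ (if does (a ≤? l) then H (suc a) else 0)
  shift zero    _ = refl
  shift (suc a) _ = refl

-- The terms at a and d ∸ a cancel mod 2, leaving the middle term when d is even.
sumTo-symmetric-parity : ∀ d (H : ℕ → ℕ) → (∀ a → a ≤ d → H a ≡ H (d ∸ a)) →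
                         parity (sumTo d H) ≡ parity (if ⌊ d % 2 ≟ 0 ⌋ then H (d / 2) else 0)
sumTo-symmetric-parity zero          H _         = refl
sumTo-symmetric-parity (suc zero)    H symmetric = begin
  parity (H 0 + H 1) ≡⟨ cong (λ z → parity (z + H 1)) (symmetric 0 z≤n) ⟩
  parity (H 1 + H 1) ≡⟨ parity[m+m]≡0ℙ (H 1) ⟩
  0ℙ                 ∎
sumTo-symmetric-parity (suc (suc d)) H symmetric = begin
  parity (H 0 + sumTo (suc d) (λ a → H (suc a)))
    ≡⟨ cong (λ z → parity (H 0 + z)) (sumTo-snoc d (λ a → H (suc a))) ⟩
  parity (H 0 + (sumTo d (λ a → H (suc a)) + H (suc (suc d))))
    ≡⟨ cong (λ z → parity (z + (sumTo d (λ a → H (suc a)) + H (suc (suc d))))) (symmetric 0 z≤n) ⟩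
  parity (H (suc (suc d)) + (sumTo d (λ a → H (suc a)) + H (suc (suc d))))
    ≡⟨ parity[m+[n+m]]≡parity[n] (H (suc (suc d))) _ ⟩
  parity (sumTo d (λ a → H (suc a)))
    ≡⟨ sumTo-symmetric-parity d (λ a → H (suc a)) inner-symmetric ⟩
  parity (if ⌊ d % 2 ≟ 0 ⌋ then H (suc (d / 2)) else 0)
    ≡⟨ cong (λ z → parity (if ⌊ d % 2 ≟ 0 ⌋ then H z else 0)) ([2+n]/2≡1+n/2 d) ⟨
  parity (if ⌊ d % 2 ≟ 0 ⌋ then H (suc (suc d) / 2) else 0) ∎
  where
  inner-symmetric : ∀ a → a ≤ d → H (suc a) ≡ H (suc (d ∸ a))
  inner-symmetric a a≤d =
    trans (symmetric (suc a) (s≤s (m≤n⇒m≤1+n a≤d))) (cong H (+-∸-assoc 1 a≤d))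

-- Sums over a box {v | v ≼ ℓ}

sumBelow : Vec ℕ N → (Vec ℕ N → ℕ) → ℕ
sumBelow []      g = g []
sumBelow (l ∷ ℓ) g = Σ[ a ≤ l ] sumBelow ℓ (λ v → g (a ∷ v))

syntax sumBelow ℓ (λ v → e) = Σ[ v ≼ ℓ ] e

sumBelow-cong : (ℓ : Vec ℕ N) {g h : Vec ℕ N → ℕ} →
                (∀ v → v ≼ ℓ → g v ≡ h v) → sumBelow ℓ g ≡ sumBelow ℓ h
sumBelow-cong []      g≡h = g≡h [] []
sumBelow-cong (l ∷ ℓ) g≡h =
  sumTo-cong l (λ a a≤l → sumBelow-cong ℓ (λ v v≼ℓ → g≡h (a ∷ v) (a≤l ∷ v≼ℓ)))

sumBelow-cong-parity : (ℓ : Vec ℕ N) {g h : Vec ℕ N → ℕ} →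
                       (∀ v → v ≼ ℓ → parity (g v) ≡ parity (h v)) →
                       parity (sumBelow ℓ g) ≡ parity (sumBelow ℓ h)
sumBelow-cong-parity []      g≡h = g≡h [] []
sumBelow-cong-parity (l ∷ ℓ) g≡h =
  sumTo-cong-parity l (λ a a≤l → sumBelow-cong-parity ℓ (λ v v≼ℓ → g≡h (a ∷ v) (a≤l ∷ v≼ℓ)))

sumBelow-+ : (ℓ : Vec ℕ N) (g h : Vec ℕ N → ℕ) →
             Σ[ v ≼ ℓ ] (g v + h v) ≡ sumBelow ℓ g + sumBelow ℓ h
sumBelow-+ []      g h = refl
sumBelow-+ (l ∷ ℓ) g h =
  trans (sumTo-cong l (λ a _ → sumBelow-+ ℓ (λ v → g (a ∷ v)) (λ v → h (a ∷ v)))) (sumTo-+ l _ _)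

sumBelow-*ˡ : (ℓ : Vec ℕ N) (c : ℕ) (g : Vec ℕ N → ℕ) → Σ[ v ≼ ℓ ] (c * g v) ≡ c * sumBelow ℓ g
sumBelow-*ˡ []      c g = refl
sumBelow-*ˡ (l ∷ ℓ) c g =
  trans (sumTo-cong l (λ a _ → sumBelow-*ˡ ℓ c (λ v → g (a ∷ v)))) (sumTo-*ˡ l c _)

sumBelow-*ʳ : (ℓ : Vec ℕ N) (c : ℕ) (g : Vec ℕ N → ℕ) → Σ[ v ≼ ℓ ] (g v * c) ≡ sumBelow ℓ g * c
sumBelow-*ʳ ℓ c g = begin
  Σ[ v ≼ ℓ ] (g v * c) ≡⟨ sumBelow-cong ℓ (λ v _ → *-comm (g v) c) ⟩
  Σ[ v ≼ ℓ ] (c * g v) ≡⟨ sumBelow-*ˡ ℓ c g ⟩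
  c * sumBelow ℓ g     ≡⟨ *-comm c _ ⟩
  sumBelow ℓ g * c     ∎

sumBelow-zero : (ℓ : Vec ℕ N) → Σ[ v ≼ ℓ ] 0 ≡ 0
sumBelow-zero ℓ = sumBelow-*ˡ ℓ 0 (λ _ → 0)

sumBelow-sumTo-comm : (ℓ : Vec ℕ N) (d : ℕ) (G : Vec ℕ N → ℕ → ℕ) →
                      Σ[ v ≼ ℓ ] Σ[ b ≤ d ] G v b ≡ Σ[ b ≤ d ] Σ[ v ≼ ℓ ] G v b
sumBelow-sumTo-comm ℓ zero    G = refl
sumBelow-sumTo-comm ℓ (suc d) G =
  trans (sumBelow-+ ℓ (λ v → G v 0) (λ v → Σ[ b ≤ d ] G v (suc b)))
        (cong (Σ[ v ≼ ℓ ] G v 0 +_) (sumBelow-sumTo-comm ℓ d (λ v b → G v (suc b))))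

sumBelow-reverse : (ℓ : Vec ℕ N) (g : Vec ℕ N → ℕ) → sumBelow ℓ g ≡ Σ[ v ≼ ℓ ] g (ℓ ⊖ v)
sumBelow-reverse []      g = refl
sumBelow-reverse (l ∷ ℓ) g =
  trans (sumTo-reverse l (λ a → Σ[ v ≼ ℓ ] g (a ∷ v)))
        (sumTo-cong l (λ a _ → sumBelow-reverse ℓ (λ v → g ((l ∸ a) ∷ v))))

sumBelow-triangle : (ℓ : Vec ℕ N) (F : Vec ℕ N → Vec ℕ N → ℕ) →
                    Σ[ m ≼ ℓ ] Σ[ n ≼ ℓ ⊖ m ] F m n ≡ Σ[ q ≼ ℓ ] Σ[ m ≼ q ] F m (q ⊖ m)
sumBelow-triangle []      F = refl
sumBelow-triangle (l ∷ ℓ) F = begin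
  Σ[ a ≤ l ] Σ[ v ≼ ℓ ] Σ[ b ≤ l ∸ a ] Σ[ w ≼ ℓ ⊖ v ] F (a ∷ v) (b ∷ w)
    ≡⟨ sumTo-cong l (λ a _ → sumBelow-sumTo-comm ℓ (l ∸ a) _) ⟩
  Σ[ a ≤ l ] Σ[ b ≤ l ∸ a ] Σ[ v ≼ ℓ ] Σ[ w ≼ ℓ ⊖ v ] F (a ∷ v) (b ∷ w)
    ≡⟨ sumTo-cong l (λ a _ → sumTo-cong (l ∸ a) (λ b _ →
         sumBelow-triangle ℓ (λ v w → F (a ∷ v) (b ∷ w)))) ⟩
  Σ[ a ≤ l ] Σ[ b ≤ l ∸ a ] Σ[ u ≼ ℓ ] Σ[ v ≼ u ] F (a ∷ v) (b ∷ (u ⊖ v))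
    ≡⟨ sumTo-triangle l (λ a b → Σ[ u ≼ ℓ ] Σ[ v ≼ u ] F (a ∷ v) (b ∷ (u ⊖ v))) ⟩
  Σ[ c ≤ l ] Σ[ a ≤ c ] Σ[ u ≼ ℓ ] Σ[ v ≼ u ] F (a ∷ v) ((c ∸ a) ∷ (u ⊖ v))
    ≡⟨ sumTo-cong l (λ c _ → sumBelow-sumTo-comm ℓ c _) ⟨
  Σ[ c ≤ l ] Σ[ u ≼ ℓ ] Σ[ a ≤ c ] Σ[ v ≼ u ] F (a ∷ v) ((c ∸ a) ∷ (u ⊖ v)) ∎

truncate : Vec ℕ N → (Vec ℕ N → ℕ) → Vec ℕ N → ℕ
truncate ℓ h v = if does (v ≼? ℓ) then h v else 0

sumBelow-truncate : {ℓ L : Vec ℕ N} (h : Vec ℕ N → ℕ) → ℓ ≼ L →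
                    sumBelow L (truncate ℓ h) ≡ sumBelow ℓ h
sumBelow-truncate h [] = refl
sumBelow-truncate {ℓ = l ∷ ℓ} {L ∷ Ls} h (l≤L ∷ ℓ≼L) =
  trans (sumTo-cong L (λ a _ → truncate-head a)) (sumTo-truncate _ l≤L)
  where
  truncate-head : ∀ a → Σ[ v ≼ Ls ] truncate (l ∷ ℓ) h (a ∷ v)
                      ≡ (if does (a ≤? l) then Σ[ v ≼ ℓ ] h (a ∷ v) else 0)
  truncate-head a with does (a ≤? l)
  ... | true  = sumBelow-truncate (λ v → h (a ∷ v)) ℓ≼L
  ... | false = sumBelow-zero Ls

dilate : (Vec ℕ N → ℕ) → Vec ℕ N → ℕ
dilate g v = if allEven? v then g (half v) else 0

sumBelow-symmetric-parity : (ℓ : Vec ℕ N) (G : Vec ℕ N → ℕ) → (∀ m → m ≼ ℓ → G m ≡ G (ℓ ⊖ m)) →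
                            parity (sumBelow ℓ G) ≡ parity (dilate G ℓ)
sumBelow-symmetric-parity []      G _         = refl
sumBelow-symmetric-parity (l ∷ ℓ) G symmetric =
  trans (sumTo-symmetric-parity l H H-symmetric) middle
  where
  H : ℕ → ℕ
  H a = Σ[ v ≼ ℓ ] G (a ∷ v)
  H-symmetric : ∀ a → a ≤ l → H a ≡ H (l ∸ a)
  H-symmetric a a≤l = trans (sumBelow-cong ℓ (λ v v≼ℓ → symmetric (a ∷ v) (a≤l ∷ v≼ℓ)))
                            (sym (sumBelow-reverse ℓ (λ v → G ((l ∸ a) ∷ v))))
  middle : parity (if ⌊ l % 2 ≟ 0 ⌋ then H (l / 2) else 0)
         ≡ parity (dilate G (l ∷ ℓ))
  middle with l % 2 ≟ 0
  ... | no  _      = refl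
  ... | yes l-even = sumBelow-symmetric-parity ℓ (λ v → G (l / 2 ∷ v))
        (λ v v≼ℓ → trans (symmetric (l / 2 ∷ v) (m/n≤m l 2 ∷ v≼ℓ))
                         (cong (λ z → G (z ∷ (ℓ ⊖ v))) (n∸n/2≡n/2 l l-even)))

-- Convolution on ℕ^N

delta : Vec ℕ N → ℕ
delta []          = 1
delta (zero  ∷ v) = delta v
delta (suc _ ∷ v) = 0

conv : (g h : Vec ℕ N → ℕ) → Vec ℕ N → ℕ
conv g h ℓ = Σ[ m ≼ ℓ ] (g m * h (ℓ ⊖ m))

sumBelow-delta : (ℓ : Vec ℕ N) (g : Vec ℕ N → ℕ) → Σ[ m ≼ ℓ ] (delta m * g m) ≡ g 𝟎
sumBelow-delta []          g = +-identityʳ (g [])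
sumBelow-delta (zero  ∷ ℓ) g = sumBelow-delta ℓ (λ v → g (0 ∷ v))
sumBelow-delta (suc l ∷ ℓ) g = begin
  Σ[ v ≼ ℓ ] (delta v * g (0 ∷ v)) + Σ[ a ≤ l ] Σ[ v ≼ ℓ ] 0
    ≡⟨ cong₂ _+_ (sumBelow-delta ℓ (λ v → g (0 ∷ v))) (sumTo-cong l (λ a _ → sumBelow-zero ℓ)) ⟩
  g 𝟎 + Σ[ a ≤ l ] 0
    ≡⟨ cong (g 𝟎 +_) (sumTo-*ˡ l 0 (λ _ → 0)) ⟩
  g 𝟎 + 0
    ≡⟨ +-identityʳ (g 𝟎) ⟩
  g 𝟎 ∎

conv-identityˡ : (g : Vec ℕ N → ℕ) (ℓ : Vec ℕ N) → conv delta g ℓ ≡ g ℓ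
conv-identityˡ g ℓ = trans (sumBelow-delta ℓ (λ m → g (ℓ ⊖ m))) (cong g (v⊖𝟎≡v ℓ))

conv-congʳ : (g : Vec ℕ N → ℕ) {h h′ : Vec ℕ N → ℕ} → (∀ v → h v ≡ h′ v) →
             (ℓ : Vec ℕ N) → conv g h ℓ ≡ conv g h′ ℓ
conv-congʳ g h≡h′ ℓ = sumBelow-cong ℓ (λ m _ → cong (g m *_) (h≡h′ (ℓ ⊖ m)))

conv-assoc : (g h p : Vec ℕ N → ℕ) (ℓ : Vec ℕ N) → conv g (conv h p) ℓ ≡ conv (conv g h) p ℓ
conv-assoc g h p ℓ = begin
  Σ[ m ≼ ℓ ] (g m * Σ[ n ≼ ℓ ⊖ m ] (h n * p ((ℓ ⊖ m) ⊖ n)))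
    ≡⟨ sumBelow-cong ℓ (λ m _ → sumBelow-*ˡ (ℓ ⊖ m) (g m) _) ⟨
  Σ[ m ≼ ℓ ] Σ[ n ≼ ℓ ⊖ m ] (g m * (h n * p ((ℓ ⊖ m) ⊖ n)))
    ≡⟨ sumBelow-triangle ℓ (λ m n → g m * (h n * p ((ℓ ⊖ m) ⊖ n))) ⟩
  Σ[ q ≼ ℓ ] Σ[ m ≼ q ] (g m * (h (q ⊖ m) * p ((ℓ ⊖ m) ⊖ (q ⊖ m))))
    ≡⟨ sumBelow-cong ℓ (λ q q≼ℓ → sumBelow-cong q (λ m m≼q → regroup q m q≼ℓ m≼q)) ⟩
  Σ[ q ≼ ℓ ] Σ[ m ≼ q ] (g m * h (q ⊖ m) * p (ℓ ⊖ q))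
    ≡⟨ sumBelow-cong ℓ (λ q _ → sumBelow-*ʳ q (p (ℓ ⊖ q)) (λ m → g m * h (q ⊖ m))) ⟩
  Σ[ q ≼ ℓ ] (Σ[ m ≼ q ] (g m * h (q ⊖ m)) * p (ℓ ⊖ q)) ∎
  where
  regroup : ∀ q m → q ≼ ℓ → m ≼ q →
            g m * (h (q ⊖ m) * p ((ℓ ⊖ m) ⊖ (q ⊖ m))) ≡ g m * h (q ⊖ m) * p (ℓ ⊖ q)
  regroup q m q≼ℓ m≼q = trans (sym (*-assoc (g m) _ _))
    (cong (λ z → g m * h (q ⊖ m) * p z) ([w⊖u]⊖[v⊖u]≡w⊖v m≼q q≼ℓ))

convPow : (Vec ℕ N → ℕ) → ℕ → Vec ℕ N → ℕ
convPow f zero    = delta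
convPow f (suc k) = conv f (convPow f k)

convPow-+ : (f : Vec ℕ N → ℕ) (a b : ℕ) (ℓ : Vec ℕ N) →
            convPow f (a + b) ℓ ≡ conv (convPow f a) (convPow f b) ℓ
convPow-+ f zero    b ℓ = sym (conv-identityˡ (convPow f b) ℓ)
convPow-+ f (suc a) b ℓ = trans (conv-congʳ f (convPow-+ f a b) ℓ)
                                (conv-assoc f (convPow f a) (convPow f b) ℓ)

conv-self-parity : (g : Vec ℕ N → ℕ) (ℓ : Vec ℕ N) → parity (conv g g ℓ) ≡ parity (dilate g ℓ)
conv-self-parity g ℓ = trans (sumBelow-symmetric-parity ℓ (λ m → g m * g (ℓ ⊖ m)) symmetric) middle
  where
  symmetric : ∀ m → m ≼ ℓ → g m * g (ℓ ⊖ m) ≡ g (ℓ ⊖ m) * g (ℓ ⊖ (ℓ ⊖ m))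
  symmetric m m≼ℓ = trans (*-comm (g m) _) (cong (λ z → g (ℓ ⊖ m) * g z) (sym (v⊖[v⊖u]≡u m≼ℓ)))
  middle : parity (dilate (λ m → g m * g (ℓ ⊖ m)) ℓ) ≡ parity (dilate g ℓ)
  middle with allEven? ℓ in ℓ-even
  ... | false = refl
  ... | true rewrite v⊖half[v]≡half[v] ℓ ℓ-even = parity[m*m]≡parity[m] (g (half ℓ))

convPow-double-parity : (f : Vec ℕ N → ℕ) (h : ℕ) (ℓ : Vec ℕ N) →
                        parity (convPow f (h + h) ℓ) ≡ parity (dilate (convPow f h) ℓ)
convPow-double-parity f h ℓ =
  trans (cong parity (convPow-+ f h h ℓ)) (conv-self-parity (convPow f h) ℓ)

-- The enumerations in binom and sumC

sumMap : {A : Set} → (A → ℕ) → List A → ℕ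
sumMap g xs = sum (L.map g xs)

sumMap-cong : {A : Set} {g h : A → ℕ} → (∀ x → g x ≡ h x) → (xs : List A) → sumMap g xs ≡ sumMap h xs
sumMap-cong g≡h xs = cong sum (map-cong g≡h xs)

sumMap-map : {A B : Set} (g : B → ℕ) (h : A → B) (xs : List A) →
             sumMap g (L.map h xs) ≡ sumMap (λ x → g (h x)) xs
sumMap-map g h xs = cong sum (sym (map-∘ xs))

sumMap-concatMap : {A B : Set} (g : B → ℕ) (h : A → List B) (xs : List A) →
                   sumMap g (L.concatMap h xs) ≡ sumMap (λ x → sumMap g (h x)) xs
sumMap-concatMap g h []       = refl
sumMap-concatMap g h (x ∷ xs) = begin
  sum (L.map g (h x L.++ L.concatMap h xs))
    ≡⟨ cong sum (map-++ g (h x) (L.concatMap h xs)) ⟩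
  sum (L.map g (h x) L.++ L.map g (L.concatMap h xs))
    ≡⟨ sum-++ (L.map g (h x)) _ ⟩
  sumMap g (h x) + sumMap g (L.concatMap h xs)
    ≡⟨ cong (sumMap g (h x) +_) (sumMap-concatMap g h xs) ⟩
  sumMap g (h x) + sumMap (λ y → sumMap g (h y)) xs ∎

sumMap-*ˡ : {A : Set} (c : ℕ) (g : A → ℕ) (xs : List A) → sumMap (λ x → c * g x) xs ≡ c * sumMap g xs
sumMap-*ˡ c g []       = sym (*-zeroʳ c)
sumMap-*ˡ c g (x ∷ xs) =
  trans (cong (c * g x +_) (sumMap-*ˡ c g xs)) (sym (*-distribˡ-+ c (g x) _))

sumMap-applyUpTo : ∀ l (g H : ℕ → ℕ) → sumMap H (L.applyUpTo g (suc l)) ≡ Σ[ a ≤ l ] H (g a)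
sumMap-applyUpTo zero    g H = +-identityʳ (H (g 0))
sumMap-applyUpTo (suc l) g H = cong (H (g 0) +_) (sumMap-applyUpTo l (λ a → g (suc a)) H)

sum-map-filter : {A : Set} {P : A → Set} (P? : Decidable P) (g h : A → ℕ) →
                 (∀ x → P x → g x ≡ h x) → (∀ x → ¬ P x → h x ≡ 0) →
                 (xs : List A) → sum (L.map g (L.filter P? xs)) ≡ sumMap h xs
sum-map-filter P? g h g≡h h≡0 []       = refl
sum-map-filter P? g h g≡h h≡0 (x ∷ xs) with P? x
... | yes Px = cong₂ _+_ (g≡h x Px) (sum-map-filter P? g h g≡h h≡0 xs)
... | no ¬Px = trans (sum-map-filter P? g h g≡h h≡0 xs) (cong (_+ sumMap h xs) (sym (h≡0 x ¬Px)))

sumMap-box : (L : Vec ℕ N) (h : Vec ℕ N → ℕ) → sumMap h (box L) ≡ sumBelow L h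
sumMap-box []      h = +-identityʳ (h [])
sumMap-box (l ∷ L) h = begin
  sumMap h (L.concatMap (λ a → L.map (a ∷_) (box L)) (L.upTo (suc l)))
    ≡⟨ sumMap-concatMap h (λ a → L.map (a ∷_) (box L)) (L.upTo (suc l)) ⟩
  sumMap (λ a → sumMap h (L.map (a ∷_) (box L))) (L.upTo (suc l))
    ≡⟨ sumMap-cong (λ a → trans (sumMap-map h (a ∷_) (box L)) (sumMap-box L (λ v → h (a ∷ v))))
                   (L.upTo (suc l)) ⟩
  sumMap (λ a → Σ[ v ≼ L ] h (a ∷ v)) (L.upTo (suc l))
    ≡⟨ sumMap-applyUpTo l (λ a → a) _ ⟩
  Σ[ a ≤ l ] Σ[ v ≼ L ] h (a ∷ v) ∎

delta-𝟎 : delta (𝟎 {N}) ≡ 1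
delta-𝟎 {zero}  = refl
delta-𝟎 {suc N} = delta-𝟎 {N}

delta-≢𝟎 : {ℓ : Vec ℕ N} → 𝟎 ≢ ℓ → delta ℓ ≡ 0
delta-≢𝟎 {ℓ = []}        𝟎≢ℓ = ⊥-elim (𝟎≢ℓ refl)
delta-≢𝟎 {ℓ = zero ∷ ℓ}  𝟎≢ℓ = delta-≢𝟎 (λ 𝟎≡ℓ → 𝟎≢ℓ (cong (0 ∷_) 𝟎≡ℓ))
delta-≢𝟎 {ℓ = suc _ ∷ ℓ} _   = refl

module _ (f : Vec ℕ N → ℕ) where

  weight : Vec ℕ N → List (Vec ℕ N) → ℕ
  weight ℓ []       = delta ℓ
  weight ℓ (m ∷ ms) = truncate ℓ (λ x → f x * weight (ℓ ⊖ x) ms) m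

  weight-vsum : (ms : List (Vec ℕ N)) → weight (vsum ms) ms ≡ prodf f ms
  weight-vsum []       = delta-𝟎 {N}
  weight-vsum (m ∷ ms) rewrite dec-true (m ≼? m ⊕ vsum ms) (u≼u⊕v m (vsum ms)) =
    cong (f m *_) (trans (cong (λ v → weight v ms) ([u⊕v]⊖u≡v m (vsum ms))) (weight-vsum ms))

  weight-¬vsum : (ms : List (Vec ℕ N)) (ℓ : Vec ℕ N) → vsum ms ≢ ℓ → weight ℓ ms ≡ 0
  weight-¬vsum []       ℓ ≢ℓ = delta-≢𝟎 ≢ℓ
  weight-¬vsum (m ∷ ms) ℓ ≢ℓ with m ≼? ℓ
  ... | no  _   = refl
  ... | yes m≼ℓ = trans (cong (f m *_) (weight-¬vsum ms (ℓ ⊖ m) ≢ℓ⊖m)) (*-zeroʳ (f m))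
    where
    ≢ℓ⊖m : vsum ms ≢ ℓ ⊖ m
    ≢ℓ⊖m eq = ≢ℓ (trans (cong (m ⊕_) eq) (u⊕[v⊖u]≡v m≼ℓ))

  tupleSum : List (Vec ℕ N) → ℕ → Vec ℕ N → ℕ
  tupleSum xs k ℓ = sumMap (weight ℓ) (tuples k xs)

  tupleSum-suc : ∀ xs k ℓ →
                 tupleSum xs (suc k) ℓ ≡ sumMap (truncate ℓ (λ x → f x * tupleSum xs k (ℓ ⊖ x))) xs
  tupleSum-suc xs k ℓ =
    trans (sumMap-concatMap (weight ℓ) (λ x → L.map (x ∷_) (tuples k xs)) xs)
          (sumMap-cong (λ x → trans (sumMap-map (weight ℓ) (x ∷_) (tuples k xs)) (first x)) xs)
    where
    first : ∀ x → sumMap (λ ms → weight ℓ (x ∷ ms)) (tuples k xs)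
                ≡ truncate ℓ (λ y → f y * tupleSum xs k (ℓ ⊖ y)) x
    first x with does (x ≼? ℓ)
    ... | true  = sumMap-*ˡ (f x) (weight (ℓ ⊖ x)) (tuples k xs)
    ... | false = sumMap-*ˡ 0 (λ _ → 0) (tuples k xs)

  tupleSum-box≡convPow : ∀ k {ℓ L : Vec ℕ N} → ℓ ≼ L → tupleSum (box L) k ℓ ≡ convPow f k ℓ
  tupleSum-box≡convPow zero             ℓ≼L = +-identityʳ _
  tupleSum-box≡convPow (suc k) {ℓ} {L} ℓ≼L = begin
    tupleSum (box L) (suc k) ℓ
      ≡⟨ tupleSum-suc (box L) k ℓ ⟩
    sumMap (truncate ℓ (λ x → f x * tupleSum (box L) k (ℓ ⊖ x))) (box L)
      ≡⟨ sumMap-cong by-induction (box L) ⟩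
    sumMap (truncate ℓ (λ x → f x * convPow f k (ℓ ⊖ x))) (box L)
      ≡⟨ sumMap-box L _ ⟩
    sumBelow L (truncate ℓ (λ x → f x * convPow f k (ℓ ⊖ x)))
      ≡⟨ sumBelow-truncate _ ℓ≼L ⟩
    convPow f (suc k) ℓ ∎
    where
    by-induction : ∀ x → truncate ℓ (λ y → f y * tupleSum (box L) k (ℓ ⊖ y)) x
                       ≡ truncate ℓ (λ y → f y * convPow f k (ℓ ⊖ y)) x
    by-induction x with x ≼? ℓ
    ... | yes x≼ℓ = cong (f x *_) (tupleSum-box≡convPow k (Pointwise.trans ≤-trans (v⊖u≼v ℓ x) ℓ≼L))
    ... | no  _   = refl

  binom≡convPow : ∀ k ℓ → binom f k ℓ ≡ convPow f k ℓ
  binom≡convPow k ℓ =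
    trans (sum-map-filter _ (prodf f) (weight ℓ) (λ { ms refl → sym (weight-vsum ms) })
                          (λ ms → weight-¬vsum ms ℓ) (tuples k (box ℓ)))
          (tupleSum-box≡convPow k (Pointwise.refl ≤-refl))

  sumC≡conv-dilate : ∀ k ℓ → sumC f k ℓ ≡ conv f (dilate (binom f (k / 2))) ℓ
  sumC≡conv-dilate k ℓ = trans (sum-map-filter (λ s → T? (allEven? (ℓ ⊖ s))) _ _ even odd (box ℓ))
                    (sumMap-box ℓ _)
    where
    even : ∀ s → T (allEven? (ℓ ⊖ s)) →
           f s * binom f (k / 2) (half (ℓ ⊖ s)) ≡ f s * dilate (binom f (k / 2)) (ℓ ⊖ s)
    even s _ with allEven? (ℓ ⊖ s)
    ... | true = refl
    odd : ∀ s → ¬ T (allEven? (ℓ ⊖ s)) → f s * dilate (binom f (k / 2)) (ℓ ⊖ s) ≡ 0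
    odd s ¬even with allEven? (ℓ ⊖ s)
    ... | true  = ⊥-elim (¬even tt)
    ... | false = *-zeroʳ (f s)

dilate-cong : {g h : Vec ℕ N → ℕ} → (∀ v → g v ≡ h v) → (v : Vec ℕ N) → dilate g v ≡ dilate h v
dilate-cong g≡h v = cong (λ z → if allEven? v then z else 0) (g≡h (half v))

dilate-odd : (g : Vec ℕ N → ℕ) (v : Vec ℕ N) → ∃ (λ i → lookup v i % 2 ≡ 1) → dilate g v ≡ 0
dilate-odd g v odd = cong (λ b → if b then g (half v) else 0) (allEven?≡false v odd)

dilate-even : (g : Vec ℕ N → ℕ) (v : Vec ℕ N) → All (λ x → x % 2 ≡ 0) v → dilate g v ≡ g (half v)
dilate-even g v evens = cong (λ b → if b then g (half v) else 0) (allEven?≡true v evens)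

binom-even-parity : (f : Vec ℕ N → ℕ) (ℓ : Vec ℕ N) (h : ℕ) {k : ℕ} → k ≡ h + h →
                    parity (binom f k ℓ) ≡ parity (dilate (binom f h) ℓ)
binom-even-parity f ℓ h refl = begin
  parity (binom f (h + h) ℓ)      ≡⟨ cong parity (binom≡convPow f (h + h) ℓ) ⟩
  parity (convPow f (h + h) ℓ)    ≡⟨ convPow-double-parity f h ℓ ⟩
  parity (dilate (convPow f h) ℓ) ≡⟨ cong parity (dilate-cong (binom≡convPow f h) ℓ) ⟨
  parity (dilate (binom f h) ℓ)   ∎

binom-odd-parity : (f : Vec ℕ N → ℕ) (ℓ : Vec ℕ N) (h : ℕ) {k : ℕ} → k ≡ suc (h + h) →
                   parity (binom f k ℓ) ≡ parity (conv f (dilate (binom f h)) ℓ)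
binom-odd-parity f ℓ h refl = begin
  parity (binom f (suc (h + h)) ℓ)
    ≡⟨ cong parity (binom≡convPow f (suc (h + h)) ℓ) ⟩
  parity (conv f (convPow f (h + h)) ℓ)
    ≡⟨ sumBelow-cong-parity ℓ (λ s _ → parity-cong-* {f s} {f s} refl (even-part s)) ⟩
  parity (conv f (dilate (binom f h)) ℓ) ∎
  where
  even-part : ∀ s → parity (convPow f (h + h) (ℓ ⊖ s)) ≡ parity (dilate (binom f h) (ℓ ⊖ s))
  even-part s = trans (sym (cong parity (binom≡convPow f (h + h) (ℓ ⊖ s))))
                      (binom-even-parity f (ℓ ⊖ s) h refl)

theorem5 : (N : ℕ) → N ≥ 1 → (f : Vec ℕ N → ℕ) → (k : ℕ) → (ℓ : Vec ℕ N) →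
    ((k % 2 ≡ 0) → (∃ λ (i : Fin N) → lookup ℓ i % 2 ≡ 1) → binom f k ℓ % 2 ≡ 0)
    × ((k % 2 ≡ 0) → All (λ x → x % 2 ≡ 0) ℓ →
         binom f k ℓ % 2 ≡ binom f (k / 2) (map (_/ 2) ℓ) % 2)
    × ((k % 2 ≡ 1) → binom f k ℓ % 2 ≡ sumC f k ℓ % 2)
theorem5 N _ f k ℓ = even-with-odd-entry , even-with-even-entries , odd
  where
  even-parity : k % 2 ≡ 0 → binom f k ℓ % 2 ≡ dilate (binom f (k / 2)) ℓ % 2
  even-parity k-even = parity⇒%2≡ (binom f k ℓ) (dilate (binom f (k / 2)) ℓ)
                                  (binom-even-parity f ℓ (k / 2) (even⇒≡half+half k k-even))

  even-with-odd-entry : k % 2 ≡ 0 → ∃ (λ i → lookup ℓ i % 2 ≡ 1) → binom f k ℓ % 2 ≡ 0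
  even-with-odd-entry k-even odd-entry =
    trans (even-parity k-even) (cong (_% 2) (dilate-odd (binom f (k / 2)) ℓ odd-entry))

  even-with-even-entries : k % 2 ≡ 0 → All (λ x → x % 2 ≡ 0) ℓ →
                           binom f k ℓ % 2 ≡ binom f (k / 2) (map (_/ 2) ℓ) % 2
  even-with-even-entries k-even evens =
    trans (even-parity k-even) (cong (_% 2) (dilate-even (binom f (k / 2)) ℓ evens))

  odd : k % 2 ≡ 1 → binom f k ℓ % 2 ≡ sumC f k ℓ % 2
  odd k-odd = begin
    binom f k ℓ % 2
      ≡⟨ parity⇒%2≡ (binom f k ℓ) (conv f (dilate (binom f (k / 2))) ℓ)
           (binom-odd-parity f ℓ (k / 2) (odd⇒≡suc[half+half] k k-odd)) ⟩
    conv f (dilate (binom f (k / 2))) ℓ % 2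
      ≡⟨ cong (_% 2) (sumC≡conv-dilate f k ℓ) ⟨
    sumC f k ℓ % 2 ∎
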